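{- If $G$ is a graph of order $n \ge 2$ and $\overline{G}$ is its complement, then $4 \le b_{\rm g}(G)\, b_{\rm g}(\overline{G}) \le 2n$.
   Context: The burning game on a finite simple graph $G$ (not necessarily connected) is played by two players, Burner and Staller. Each vertex is either burned or unburned, and once burned it stays burned. In round 1 the starting player chooses one unburned vertex and burns it (selection phase only). Each round $t \ge 2$ consists of a spreading phase, in which every unburned vertex with a burned neighbor becomes burned, followed, if unburned vertices remain, by a selection phase in which the player whose turn it is burns one unburned vertex; the two players make the selections alternately. The game ends in the first round in which all vertices are burned (this may happen right after a spreading phase), and its length is the number of that round. Burner wants to minimize the length and Staller to maximize it. $b_{\rm g}(G)$ is the length under optimal play when Burner makes the first selection. -}

module Defs where

open import Data.Nat using (ℕ; zero; suc; _⊔_; _⊓_)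
open import Data.Bool using (Bool; true; false; not; _∧_; _∨_; if_then_else_)
open import Data.Bool.Properties using (∧-zeroʳ)
open import Data.Fin using (Fin; _≟_)
open import Data.List using (List; []; _∷_; allFin; filter; map)
open import Data.Bool.ListAction using (any; all)
open import Relation.Nullary using (does)
open import Relation.Binary.PropositionalEquality using (_≡_; refl; trans; cong₂)

-- A finite simple graph on the vertex set Fin n (not necessarily connected):
-- symmetric, irreflexive Boolean adjacency.
record Graph (n : ℕ) : Set where
  field
    adj   : Fin n → Fin n → Bool
    sym   : ∀ u v → adj u v ≡ adj v u
    irref : ∀ v → adj v v ≡ false
open Graph public

eqb : ∀ {n} → Fin n → Fin n → Bool
eqb u v = does (u ≟ v)

eqb-sym : ∀ {n} (u v : Fin n) → eqb u v ≡ eqb v u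
eqb-sym u v with u ≟ v | v ≟ u
... | Relation.Nullary.yes _ | Relation.Nullary.yes _ = refl
... | Relation.Nullary.no _  | Relation.Nullary.no _  = refl
... | Relation.Nullary.yes refl | Relation.Nullary.no ¬p = Data.Empty.⊥-elim (¬p refl)
  where import Data.Empty
... | Relation.Nullary.no ¬p | Relation.Nullary.yes refl = Data.Empty.⊥-elim (¬p refl)
  where import Data.Empty

eqb-refl : ∀ {n} (v : Fin n) → eqb v v ≡ true
eqb-refl v with v ≟ v
... | Relation.Nullary.yes _ = refl
... | Relation.Nullary.no ¬p = Data.Empty.⊥-elim (¬p refl)
  where import Data.Empty

complement : ∀ {n} → Graph n → Graph n
complement G = record
  { adj   = λ u v → not (adj G u v) ∧ not (eqb u v)
  ; sym   = λ u v → cong₂ (λ a b → not a ∧ not b) (sym G u v) (eqb-sym u v)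
  ; irref = λ v → trans (cong₂ (λ a b → not a ∧ not b) refl (eqb-refl v))
                        (∧-zeroʳ (not (adj G v v)))
  }

Burned : ℕ → Set
Burned n = Fin n → Bool

data Player : Set where
  burner staller : Player

other : Player → Player
other burner  = staller
other staller = burner

allBurned : ∀ {n} → Burned n → Bool
allBurned {n} B = all B (allFin n)

spread : ∀ {n} → Graph n → Burned n → Burned n
spread {n} G B v = B v ∨ any (λ u → adj G u v ∧ B u) (allFin n)

burn : ∀ {n} → Burned n → Fin n → Burned n
burn B v u = B u ∨ eqb u v

unburned : ∀ {n} → Burned n → List (Fin n)
unburned {n} B = filter (λ v → Data.Bool._≟_ (B v) false) (allFin n)
  where import Data.Bool

-- optimum of a list of values for the given player
-- (Burner minimises, Staller maximises); the empty case never arises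
-- in the game below since a selection happens only if unburned vertices remain.
opt : Player → List ℕ → ℕ
opt p []       = 0
opt p (x ∷ []) = x
opt burner  (x ∷ y ∷ xs) = x ⊓ opt burner  (y ∷ xs)
opt staller (x ∷ y ∷ xs) = x ⊔ opt staller (y ∷ xs)

mutual
  -- rest f p B : number of further rounds until the game ends, when B is
  -- the burned set at the end of a round and p makes the next selection.  The fuel f bounds the
  -- number of further selections; each selection burns a new vertex, so
  -- fuel n is always sufficient.
  rest : ∀ {n} → Graph n → ℕ → Player → Burned n → ℕ
  rest G f p B = if allBurned B then 0 else nextRound G f p B

  nextRound : ∀ {n} → Graph n → ℕ → Player → Burned n → ℕ
  nextRound G zero    p B = 0
  nextRound G (suc f) p B =
    let B' = spread G B in
    suc (if allBurned B' then 0
         else opt p (map (λ v → rest G f (other p) (burn B' v)) (unburned B')))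

-- Game burning number with Burner making the first selection:
-- round 1 is Burner's selection of a vertex, then the game continues.
noneBurned : ∀ {n} → Burned n
noneBurned _ = false

bg : ∀ {n} → Graph n → ℕ
bg {n} G = suc (opt burner (map (λ v → rest G n staller (burn noneBurned v)) (allFin n)))

-- Each round burns at least one new vertex, so b_g(G) ≤ n, and one vertex cannot burn n ≥ 2
-- vertices in a single round, so b_g(G) ≥ 2; this gives the lower bound 4.
-- For the upper bound: a vertex of degree ≤ 1 in G has degree ≥ n - 2 in the complement and
-- burns it within two rounds, and symmetrically for a vertex of degree ≥ n - 2 in G; then
-- b_g(G) b_g(Ḡ) ≤ 2n.  Otherwise G and Ḡ both have minimum degree ≥ 2, so from the second
-- round on every round burns at least two new vertices and b_g ≤ ⌈n/2⌉ for both; moreover G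
-- or Ḡ has a vertex of eccentricity ≤ 2, from which it burns within three rounds, and
-- 3 ⌈n/2⌉ ≤ 2n for n ≥ 3.

module Submission where

open import Defs
open import Data.Bool using (Bool; true; false; T; _∨_; _∧_; if_then_else_)
open import Data.Bool.Properties using (T-∨; T-∧; T-≡; T?)
open import Data.Empty using (⊥-elim)
open import Data.Fin using (Fin; zero; suc; _≟_)
open import Data.Fin.Properties using (any?)
open import Data.List using (List; []; _∷_; allFin)
open import Data.List.Extrema.Nat using (argmin; argmax; f[argmin]≤f[xs]; f[xs]≤f[argmax])
open import Data.List.Membership.Propositional using (_∈_; lose)
open import Data.List.Membership.Propositional.Properties using (∈-map⁺; ∈-allFin)
open import Data.List.Relation.Unary.All as All using (All; []; _∷_)
open import Data.List.Relation.Unary.All.Properties using (all⁺; all⁻; all-filter; map⁺)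
open import Data.List.Relation.Unary.Any using (here; there)
open import Data.List.Relation.Unary.Any.Properties using (any⁺)
open import Data.Nat using (ℕ; zero; suc; _+_; _*_; _≤_; _<_; z≤n; s≤s; _<ᵇ_; _≤?_; _<?_)
open import Data.Nat.Properties hiding (_≟_)
open import Data.Nat.Solver using (module +-*-Solver)
open import Data.Product using (_×_; _,_; ∃)
open import Data.Sum using (_⊎_; inj₁; inj₂; [_,_]′)
open import Function using (_∘_)
open import Function.Bundles using (module Equivalence)
open import Relation.Binary.PropositionalEquality as ≡ using (_≡_; _≢_; refl; cong; subst)
open import Relation.Nullary using (¬_; Dec; yes; no)
open import Relation.Nullary.Decidable using (_×-dec_)
open import Relation.Unary using (_⊆_)
open +-*-Solver using (solve; _:+_; _:=_; con)
open ≤-Reasoning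

-- Counting a Boolean predicate on Fin n

count : ∀ {n} → (Fin n → Bool) → ℕ
count {zero}  p = 0
count {suc n} p = if p zero then suc (count (p ∘ suc)) else count (p ∘ suc)

count≤n : ∀ {n} (p : Fin n → Bool) → count p ≤ n
count≤n {zero}  p = z≤n
count≤n {suc n} p with p zero
... | true  = s≤s (count≤n (p ∘ suc))
... | false = m≤n⇒m≤1+n (count≤n (p ∘ suc))

count≡0 : ∀ {n} {p : Fin n → Bool} → (∀ x → ¬ T (p x)) → count p ≡ 0
count≡0 {zero}          _  = refl
count≡0 {suc n} {p} ¬p with p zero in p0
... | true  = ⊥-elim (¬p zero (subst T (≡.sym p0) _))
... | false = count≡0 (¬p ∘ suc)

count-mono : ∀ {n} (p q : Fin n → Bool) → T ∘ p ⊆ T ∘ q → count p ≤ count q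
count-mono {zero}  p q _   = z≤n
count-mono {suc n} p q p⊆q with p zero in p0 | q zero in q0
... | true  | true  = s≤s (count-mono (p ∘ suc) (q ∘ suc) p⊆q)
... | false | true  = m≤n⇒m≤1+n (count-mono (p ∘ suc) (q ∘ suc) p⊆q)
... | false | false = count-mono (p ∘ suc) (q ∘ suc) p⊆q
... | true  | false = ⊥-elim (subst T q0 (p⊆q (subst T (≡.sym p0) _)))

count-< : ∀ {n} (p q : Fin n → Bool) → T ∘ p ⊆ T ∘ q →
          ∀ {x} → T (q x) → ¬ T (p x) → count p < count q
count-< {suc n} p q p⊆q {x} qx ¬px with p zero in p0 | q zero in q0
count-< p q p⊆q {zero}  qx ¬px | true  | _     = ⊥-elim (¬px (subst T (≡.sym p0) _))
count-< p q p⊆q {zero}  qx ¬px | false | true  = s≤s (count-mono (p ∘ suc) (q ∘ suc) p⊆q)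
count-< p q p⊆q {zero}  qx ¬px | false | false = ⊥-elim (subst T q0 qx)
count-< p q p⊆q {suc x} qx ¬px | true  | true  = s≤s (count-< (p ∘ suc) (q ∘ suc) p⊆q {x} qx ¬px)
count-< p q p⊆q {suc x} qx ¬px | false | true  = m≤n⇒m≤1+n (count-< (p ∘ suc) (q ∘ suc) p⊆q {x} qx ¬px)
count-< p q p⊆q {suc x} qx ¬px | false | false = count-< (p ∘ suc) (q ∘ suc) p⊆q {x} qx ¬px
count-< p q p⊆q {suc x} qx ¬px | true  | false = ⊥-elim (subst T q0 (p⊆q (subst T (≡.sym p0) _)))

⊆∧count≤⇒⊇ : ∀ {n} (p q : Fin n → Bool) → T ∘ p ⊆ T ∘ q → count q ≤ count p → T ∘ q ⊆ T ∘ p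
⊆∧count≤⇒⊇ p q p⊆q q≤p {x} qx with T? (p x)
... | yes px = px
... | no ¬px = ⊥-elim (<⇒≱ (count-< p q p⊆q {x} qx ¬px) q≤p)

n≤count⇒all : ∀ {n} {p : Fin n → Bool} → n ≤ count p → ∀ x → T (p x)
n≤count⇒all {suc n} {p} n≤ x with p zero in p0
n≤count⇒all n≤       zero    | true  = subst T (≡.sym p0) _
n≤count⇒all (s≤s n≤) (suc x) | true  = n≤count⇒all n≤ x
n≤count⇒all {suc n} {p} n≤ x | false = ⊥-elim (<⇒≱ (s≤s (count≤n (p ∘ suc))) n≤)

all⇒n≤count : ∀ {n} {p : Fin n → Bool} → (∀ x → T (p x)) → n ≤ count p
all⇒n≤count {zero}          _ = z≤n
all⇒n≤count {suc n} {p} all-p with p zero | all-p zero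
... | true | _ = s≤s (all⇒n≤count (all-p ∘ suc))

count-∨+count-∧ : ∀ {n} (p q : Fin n → Bool) →
  count (λ x → p x ∨ q x) + count (λ x → p x ∧ q x) ≡ count p + count q
count-∨+count-∧ {zero}  p q = refl
count-∨+count-∧ {suc n} p q with p zero | q zero | count-∨+count-∧ (p ∘ suc) (q ∘ suc)
... | true  | true  | ih = cong suc (≡.trans (+-suc _ _) (≡.trans (cong suc ih) (≡.sym (+-suc _ _))))
... | true  | false | ih = cong suc ih
... | false | true  | ih = ≡.trans (cong suc ih) (≡.sym (+-suc _ _))
... | false | false | ih = ih

count-∨≤ : ∀ {n} (p q : Fin n → Bool) → count (λ x → p x ∨ q x) ≤ count p + count q
count-∨≤ p q = ≤-trans (m≤m+n _ _) (≤-reflexive (count-∨+count-∧ p q))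

count-∨-disjoint : ∀ {n} (p q : Fin n → Bool) → (∀ x → ¬ (T (p x) × T (q x))) →
  count p + count q ≡ count (λ x → p x ∨ q x)
count-∨-disjoint p q disjoint =
  ≡.trans (≡.sym (count-∨+count-∧ p q))
    (≡.trans (cong (count (λ x → p x ∨ q x) +_) (count≡0 (λ x → disjoint x ∘ Equivalence.to T-∧)))
      (+-identityʳ _))

count-eqb : ∀ {n} (v : Fin n) → count (λ x → eqb x v) ≡ 1
count-eqb {suc n} zero = cong suc (count≡0 {n} λ _ ())
count-eqb (suc v) = count-eqb v

-- Burning and spreading

allBurned⇒ : ∀ {n} {B : Burned n} → T (allBurned B) → ∀ x → T (B x)
allBurned⇒ {n} {B} h x = All.lookup (all⁺ B (allFin n) h) (∈-allFin x)

⇒allBurned : ∀ {n} {B : Burned n} → (∀ x → T (B x)) → T (allBurned B)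
⇒allBurned {n} {B} h = all⁻ B (All.tabulate {xs = allFin n} λ {x} _ → h x)

spread-⊇ : ∀ {n} (G : Graph n) (B : Burned n) → T ∘ B ⊆ T ∘ spread G B
spread-⊇ G B bx = Equivalence.from T-∨ (inj₁ bx)

spread-adj : ∀ {n} (G : Graph n) (B : Burned n) {u v} → T (B u) → T (adj G u v) → T (spread G B v)
spread-adj {n} G B {u} bu uv =
  Equivalence.from T-∨ (inj₂ (any⁺ _ (lose (∈-allFin u) (Equivalence.from T-∧ (uv , bu)))))

burn-⊇ : ∀ {n} (B : Burned n) v → T ∘ B ⊆ T ∘ burn B v
burn-⊇ B v bx = Equivalence.from T-∨ (inj₁ bx)

burn-self : ∀ {n} (B : Burned n) v → T (burn B v v)
burn-self B v = Equivalence.from (T-∨ {B v}) (inj₂ (subst T (≡.sym (eqb-refl v)) _))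

count-burn : ∀ {n} (B : Burned n) v → ¬ T (B v) → suc (count B) ≤ count (burn B v)
count-burn B v ¬bv = count-< B (burn B v) (burn-⊇ B v) (burn-self B v) ¬bv

eqb⇒≡ : ∀ {n} {x v : Fin n} → T (eqb x v) → x ≡ v
eqb⇒≡ {x = x} {v} x=v with x ≟ v
... | yes x≡v = x≡v
... | no  _   = ⊥-elim x=v

adj⇒≢ : ∀ {n} (G : Graph n) {v x} → T (adj G v x) → x ≢ v
adj⇒≢ G vx refl = subst T (irref G _) vx

deg : ∀ {n} → Graph n → Fin n → ℕ
deg G v = count (adj G v)

closedNbhd : ∀ {n} → Graph n → Fin n → Fin n → Bool
closedNbhd G v = burn (adj G v) v

suc-deg≤count-closedNbhd : ∀ {n} (G : Graph n) v → suc (deg G v) ≤ count (closedNbhd G v)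
suc-deg≤count-closedNbhd G v = count-burn (adj G v) v (subst T (irref G v))

closedNbhd⊆spread : ∀ {n} (G : Graph n) v → T ∘ closedNbhd G v ⊆ T ∘ spread G (burn noneBurned v)
closedNbhd⊆spread G v {x} x∈N[v] with Equivalence.to T-∨ x∈N[v]
... | inj₁ vx  = spread-adj G _ (burn-self noneBurned v) vx
... | inj₂ x=v = spread-⊇ G _ x=v

-- Rounds of the game

opt≤ : ∀ p {j} {xs : List ℕ} → All (_≤ j) xs → opt p xs ≤ j
opt≤ p       []                   = z≤n
opt≤ p       (x≤j ∷ [])           = x≤j
opt≤ burner  (x≤j ∷ _ ∷ _)        = m≤n⇒m⊓o≤n _ x≤j
opt≤ staller (x≤j ∷ xs≤j@(_ ∷ _)) = ⊔-lub x≤j (opt≤ staller xs≤j)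

≤opt : ∀ p {k x} {xs : List ℕ} → All (k ≤_) (x ∷ xs) → k ≤ opt p (x ∷ xs)
≤opt p       (k≤x ∷ [])           = k≤x
≤opt burner  (k≤x ∷ ks≤xs@(_ ∷ _)) = ⊓-glb k≤x (≤opt burner ks≤xs)
≤opt staller (k≤x ∷ _ ∷ _)        = ≤-trans k≤x (m≤m⊔n _ _)

opt-burner≤ : ∀ {x} {xs : List ℕ} → x ∈ xs → opt burner xs ≤ x
opt-burner≤ {xs = _ ∷ []}    (here refl) = ≤-refl
opt-burner≤ {xs = _ ∷ _ ∷ _} (here refl) = m⊓n≤m _ _
opt-burner≤ {xs = y ∷ _ ∷ _} (there x∈) = ≤-trans (m⊓n≤n y _) (opt-burner≤ x∈)

LastsAtMost : ∀ {n} → Graph n → ℕ → Burned n → Set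
LastsAtMost G j B = ∀ fuel p → rest G fuel p B ≤ j

lastsAtMost-zero : ∀ {n} {G : Graph n} {B : Burned n} → (∀ x → T (B x)) → LastsAtMost G 0 B
lastsAtMost-zero {B = B} all-B _ _
  rewrite Equivalence.to T-≡ (⇒allBurned {B = B} all-B) = z≤n

lastsAtMost-suc : ∀ {n} {G : Graph n} {j} {B : Burned n} →
  (∀ v → ¬ T (spread G B v) → LastsAtMost G j (burn (spread G B) v)) →
  LastsAtMost G (suc j) B
lastsAtMost-suc {n} {G} {j} {B} next fuel p with allBurned B
... | true  = z≤n
... | false = nextRound≤ fuel
  where
  nextRound≤ : ∀ fuel → nextRound G fuel p B ≤ suc j
  nextRound≤ zero = z≤n
  nextRound≤ (suc fuel) with allBurned (spread G B)
  ... | true  = s≤s z≤n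
  ... | false = s≤s (opt≤ p (map⁺ (All.map (λ {v} v∉ → next v (subst T v∉) fuel (other p))
                                            (all-filter _ (allFin n)))))

bg≤suc : ∀ {n} (G : Graph n) {j} v → LastsAtMost G j (burn noneBurned v) → bg G ≤ suc j
bg≤suc {n} G v lasts = s≤s (≤-trans (opt-burner≤ (∈-map⁺ _ (∈-allFin v))) (lasts n staller))

another-vertex : ∀ {m} (v : Fin (suc (suc m))) → ∃ λ w → w ≢ v
another-vertex zero    = suc zero , λ ()
another-vertex (suc _) = zero , λ ()

some-vertex-unburned : ∀ {m} v → ¬ T (allBurned (burn (noneBurned {suc (suc m)}) v))
some-vertex-unburned v all-burned with another-vertex v
... | w , w≢v = w≢v (eqb⇒≡ {x = w} (allBurned⇒ {B = burn noneBurned v} all-burned w))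

1≤rest : ∀ {n} (G : Graph n) fuel p {B : Burned n} → ¬ T (allBurned B) → 1 ≤ rest G (suc fuel) p B
1≤rest G fuel p {B} not-all with allBurned B
... | true  = ⊥-elim (not-all _)
... | false = s≤s z≤n

2≤bg : ∀ {m} (G : Graph (suc (suc m))) → 2 ≤ bg G
2≤bg {m} G = s≤s (≤opt burner (map⁺ (All.tabulate {xs = allFin (suc (suc m))}
  λ {v} _ → 1≤rest G (suc m) staller {burn noneBurned v} (some-vertex-unburned v))))

module _ {n} (G : Graph n) (Φ : Burned n → ℕ) (k : ℕ)
         (Φ-complete : ∀ {B} → n ≤ Φ B → ∀ x → T (B x))
         (Φ-round : ∀ B v → ¬ T (spread G B v) → k + Φ B ≤ Φ (burn (spread G B) v)) where

  lastsAtMost-potential : ∀ j {B} → n ≤ j * k + Φ B → LastsAtMost G j B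
  lastsAtMost-potential zero    n≤ = lastsAtMost-zero (Φ-complete n≤)
  lastsAtMost-potential (suc j) {B} n≤ = lastsAtMost-suc λ v v∉ →
    lastsAtMost-potential j (begin
      n                                  ≤⟨ n≤ ⟩
      (k + j * k) + Φ B                  ≡⟨ ≡.cong (_+ Φ B) (+-comm k (j * k)) ⟩
      (j * k + k) + Φ B                  ≡⟨ +-assoc (j * k) k (Φ B) ⟩
      j * k + (k + Φ B)                  ≤⟨ +-monoʳ-≤ (j * k) (Φ-round B v v∉) ⟩
      j * k + Φ (burn (spread G B) v)    ∎)

lastsAtMost-count : ∀ {n} (G : Graph n) j {B : Burned n} → n ≤ j + count B → LastsAtMost G j B
lastsAtMost-count {n} G j {B} n≤ = lastsAtMost-potential G count 1 n≤count⇒all count-round j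
  (subst (λ i → n ≤ i + count B) (≡.sym (*-identityʳ j)) n≤)
  where
  count-round : ∀ B′ v → ¬ T (spread G B′ v) → 1 + count B′ ≤ count (burn (spread G B′) v)
  count-round B′ v v∉ = begin
    suc (count B′)                ≤⟨ s≤s (count-mono B′ _ (spread-⊇ G B′)) ⟩
    suc (count (spread G B′))     ≤⟨ count-burn (spread G B′) v v∉ ⟩
    count (burn (spread G B′) v)  ∎

bg≤n : ∀ {m} (G : Graph (suc m)) → bg G ≤ suc m
bg≤n {m} G = bg≤suc G zero (lastsAtMost-count G m (begin
  suc m                                      ≡⟨ +-comm 1 m ⟩
  m + 1                                      ≤⟨ +-monoʳ-≤ m (≤-trans (s≤s z≤n) (count-burn (noneBurned {suc m}) zero λ ())) ⟩
  m + count (burn (noneBurned {suc m}) zero) ∎))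

bg≤2 : ∀ {n} (G : Graph n) v → n ≤ 2 + deg G v → bg G ≤ 2
bg≤2 {n} G v n≤ = bg≤suc G v (lastsAtMost-suc λ y y∉ → lastsAtMost-count G 0 (begin
  n                                              ≤⟨ n≤ ⟩
  suc (suc (deg G v))                            ≤⟨ s≤s (suc-deg≤count-closedNbhd G v) ⟩
  suc (count (closedNbhd G v))                   ≤⟨ s≤s (count-mono (closedNbhd G v) _ (closedNbhd⊆spread G v)) ⟩
  suc (count (spread G (burn noneBurned v)))     ≤⟨ count-burn _ y y∉ ⟩
  count (burn (spread G (burn noneBurned v)) y)  ∎))

Eccentricity≤2 : ∀ {n} → Graph n → Fin n → Set
Eccentricity≤2 G v = ∀ w → w ≡ v ⊎ T (adj G v w) ⊎ ∃ λ x → T (adj G v x) × T (adj G x w)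

bg≤3 : ∀ {n} (G : Graph n) v → Eccentricity≤2 G v → bg G ≤ 3
bg≤3 {n} G v ecc = bg≤suc G v (lastsAtMost-suc λ y _ → lastsAtMost-suc λ z z∉ → ⊥-elim (z∉ (second-spread z)))
  where
  S₁ : Burned n
  S₁ = spread G (burn noneBurned v)
  N[v]⊆S₁ : T ∘ closedNbhd G v ⊆ T ∘ S₁
  N[v]⊆S₁ = closedNbhd⊆spread G v
  second-spread : ∀ {y} w → T (spread G (burn S₁ y) w)
  second-spread {y} w with ecc w
  ... | inj₁ refl = spread-⊇ G _ (burn-⊇ S₁ y (N[v]⊆S₁ (burn-self (adj G v) v)))
  ... | inj₂ (inj₁ vw) = spread-⊇ G _ (burn-⊇ S₁ y (N[v]⊆S₁ (burn-⊇ (adj G v) v vw)))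
  ... | inj₂ (inj₂ (x , vx , xw)) = spread-adj G _ (burn-⊇ S₁ y (N[v]⊆S₁ (burn-⊇ (adj G v) v vx))) xw

-- Minimum degree at least two

count+deg≤count-spread : ∀ {n} (G : Graph n) (B : Burned n) {v} → T (B v) →
  (∀ {x} → T (adj G v x) → ¬ T (B x)) → count B + deg G v ≤ count (spread G B)
count+deg≤count-spread G B {v} bv nbr∉ = begin
  count B + deg G v               ≡⟨ count-∨-disjoint B (adj G v) (λ _ (bx , vx) → nbr∉ vx bx) ⟩
  count (λ x → B x ∨ adj G v x)   ≤⟨ count-mono _ (spread G B) (λ {x} → [ spread-⊇ G B , spread-adj G B bv ]′ ∘ Equivalence.to (T-∨ {B x})) ⟩
  count (spread G B)              ∎

-- Counts the coming round in advance when the next spreading phase alone burns at least two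
-- vertices; under minimum degree at least 2 this grows by at least 2 per round.
progress : ∀ {n} → Graph n → Burned n → ℕ
progress G B = if suc (count B) <ᵇ count (spread G B) then suc (count B) else count B

count≤progress : ∀ {n} (G : Graph n) (B : Burned n) → count B ≤ progress G B
count≤progress G B with suc (count B) <ᵇ count (spread G B)
... | true  = n≤1+n (count B)
... | false = ≤-refl

progress≤suc[count] : ∀ {n} (G : Graph n) (B : Burned n) → progress G B ≤ suc (count B)
progress≤suc[count] G B with suc (count B) <ᵇ count (spread G B)
... | true  = ≤-refl
... | false = n≤1+n (count B)

progress-flagged : ∀ {n} (G : Graph n) (B : Burned n) → suc (count B) < count (spread G B) →
                   progress G B ≡ suc (count B)
progress-flagged G B gain with suc (count B) <ᵇ count (spread G B) | <⇒<ᵇ gain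
... | true | _ = refl

progress-unflagged : ∀ {n} (G : Graph n) (B : Burned n) → ¬ suc (count B) < count (spread G B) →
                     progress G B ≡ count B
progress-unflagged G B no-gain with suc (count B) <ᵇ count (spread G B) in flag
... | true  = ⊥-elim (no-gain (<ᵇ⇒< _ _ (subst T (≡.sym flag) _)))
... | false = refl

progress-complete : ∀ {n} {G : Graph n} {B : Burned n} → n ≤ progress G B → ∀ x → T (B x)
progress-complete {n} {G} {B} n≤ with suc (count B) <? count (spread G B)
... | yes gain = ⊥-elim (<⇒≱ (<-≤-trans gain (count≤n (spread G B)))
                             (≤-trans n≤ (≤-reflexive (progress-flagged G B gain))))
... | no no-gain = n≤count⇒all (≤-trans n≤ (≤-reflexive (progress-unflagged G B no-gain)))

module _ {n} {G : Graph n} (δ≥2 : ∀ w → 2 ≤ deg G w) where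

  progress-flagged-at-fresh-vertex : ∀ (B : Burned n) {v} → T (B v) →
    (∀ {x} → T (adj G v x) → ¬ T (B x)) → progress G B ≡ suc (count B)
  progress-flagged-at-fresh-vertex B {v} bv nbr∉ = progress-flagged G B (begin
    2 + count B          ≡⟨ +-comm 2 (count B) ⟩
    count B + 2          ≤⟨ +-monoʳ-≤ (count B) (δ≥2 v) ⟩
    count B + deg G v    ≤⟨ count+deg≤count-spread G B bv nbr∉ ⟩
    count (spread G B)   ∎)

  progress-round : ∀ (B : Burned n) v → ¬ T (spread G B v) →
                   2 + progress G B ≤ progress G (burn (spread G B) v)
  progress-round B v v∉S = by-gain (suc (count B) <? count S) (count B <? count S)
    where
    S  = spread G B
    S′ = burn S v
    ≤progress-S′ : ∀ {k} → k ≤ suc (count S) → k ≤ progress G S′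
    ≤progress-S′ k≤ = ≤-trans k≤ (≤-trans (count-burn S v v∉S) (count≤progress G S′))
    by-gain : Dec (suc (count B) < count S) → Dec (count B < count S) → 2 + progress G B ≤ progress G S′
    by-gain (yes two-new) _ = ≤progress-S′ (≤-trans (+-monoʳ-≤ 2 (progress≤suc[count] G B)) (s≤s two-new))
    by-gain (no ¬two-new) (yes one-new) =
      ≤progress-S′ (≤-trans (≤-reflexive (cong (2 +_) (progress-unflagged G B ¬two-new))) (s≤s one-new))
    by-gain (no ¬two-new) (no ¬one-new) = begin
      2 + progress G B     ≡⟨ cong (2 +_) (progress-unflagged G B ¬two-new) ⟩
      2 + count B          ≤⟨ s≤s (s≤s (count-mono B S (spread-⊇ G B))) ⟩
      2 + count S          ≤⟨ s≤s (count-burn S v v∉S) ⟩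
      suc (count S′)       ≡⟨ ≡.sym (progress-flagged-at-fresh-vertex S′ (burn-self S v) nbr∉) ⟩
      progress G S′        ∎
      where
      S⊆B : T ∘ S ⊆ T ∘ B
      S⊆B = ⊆∧count≤⇒⊇ B S (spread-⊇ G B) (≮⇒≥ ¬one-new)
      -- since spreading from B burned nothing, a neighbour of v in S would already have burned v
      nbr∉ : ∀ {x} → T (adj G v x) → ¬ T (S′ x)
      nbr∉ {x} vx x∈S′ with Equivalence.to (T-∨ {S x}) x∈S′
      ... | inj₁ sx  = v∉S (spread-adj G B (S⊆B sx) (subst T (Graph.sym G v x) vx))
      ... | inj₂ x=v = adj⇒≢ G vx (eqb⇒≡ x=v)

  2≤progress-start : ∀ v → 2 ≤ progress G (burn noneBurned v)
  2≤progress-start v = begin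
    2                                ≤⟨ s≤s (≤-trans (s≤s z≤n) (count-burn noneBurned v λ ())) ⟩
    suc (count (burn noneBurned v))  ≡⟨ ≡.sym (progress-flagged-at-fresh-vertex _ (burn-self noneBurned v) nbr∉) ⟩
    progress G (burn noneBurned v)   ∎
    where
    nbr∉ : ∀ {x} → T (adj G v x) → ¬ T (burn noneBurned v x)
    nbr∉ vx x=v = adj⇒≢ G vx (eqb⇒≡ x=v)

δ≥2⇒bg≤suc : ∀ {m} (G : Graph (suc m)) → (∀ w → 2 ≤ deg G w) → ∀ j → suc m ≤ j * 2 + 2 → bg G ≤ suc j
δ≥2⇒bg≤suc {m} G δ≥2 j n≤ = bg≤suc G zero
  (lastsAtMost-potential G (progress G) 2 (progress-complete {G = G}) (progress-round {G = G} δ≥2) j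
    (≤-trans n≤ (+-monoʳ-≤ (j * 2) (2≤progress-start {G = G} δ≥2 zero))))

-- A graph and its complement

n≤suc[deg+deg-complement] : ∀ {n} (G : Graph n) w → n ≤ suc (deg G w + deg (complement G) w)
n≤suc[deg+deg-complement] {n} G w = begin
  n                                                   ≤⟨ all⇒n≤count covers ⟩
  count (burn (λ x → adj G w x ∨ adj Ḡ w x) w)        ≤⟨ count-∨≤ _ (λ x → eqb x w) ⟩
  count (λ x → adj G w x ∨ adj Ḡ w x) + count (λ x → eqb x w)
                                                      ≤⟨ +-mono-≤ (count-∨≤ (adj G w) (adj Ḡ w)) (≤-reflexive (count-eqb w)) ⟩
  deg G w + deg Ḡ w + 1                               ≡⟨ +-comm _ 1 ⟩
  suc (deg G w + deg Ḡ w)                             ∎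
  where
  Ḡ = complement G
  covers : ∀ x → T (burn (λ x → adj G w x ∨ adj Ḡ w x) w x)
  covers x rewrite eqb-sym x w with adj G w x | eqb w x
  ... | true  | _     = _
  ... | false | false = _
  ... | false | true  = _

common-neighbour : ∀ {n} (G : Graph n) {v w} → v ≢ w → ¬ T (adj G v w) → n ≤ suc (deg G v + deg G w) →
                   ∃ λ x → T (adj G v x) × T (adj G x w)
common-neighbour {n} G {v} {w} v≢w ¬vw n≤ with any? (λ x → T? (adj G v x) ×-dec T? (adj G w x))
... | yes (x , vx , wx) = x , vx , subst T (Graph.sym G w x) wx
... | no ¬common = ⊥-elim (<⇒≱ too-many (count≤n (λ x → closedNbhd G v x ∨ closedNbhd G w x)))
  where
  disjoint : ∀ x → ¬ (T (closedNbhd G v x) × T (closedNbhd G w x))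
  disjoint x (x∈N[v] , x∈N[w]) with Equivalence.to (T-∨ {adj G v x}) x∈N[v] | Equivalence.to (T-∨ {adj G w x}) x∈N[w]
  ... | inj₁ vx  | inj₁ wx  = ¬common (x , vx , wx)
  ... | inj₁ vx  | inj₂ x=w = ¬vw (subst (T ∘ adj G v) (eqb⇒≡ x=w) vx)
  ... | inj₂ x=v | inj₁ wx  = ¬vw (subst T (Graph.sym G w v) (subst (T ∘ adj G w) (eqb⇒≡ x=v) wx))
  ... | inj₂ x=v | inj₂ x=w = v≢w (≡.trans (≡.sym (eqb⇒≡ {x = x} x=v)) (eqb⇒≡ {x = x} x=w))
  too-many : n < count (λ x → closedNbhd G v x ∨ closedNbhd G w x)
  too-many = begin-strict
    n                                                     ≤⟨ n≤ ⟩
    suc (deg G v + deg G w)                               <⟨ s≤s (≤-reflexive (≡.sym (+-suc (deg G v) (deg G w)))) ⟩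
    suc (deg G v) + suc (deg G w)                         ≤⟨ +-mono-≤ (suc-deg≤count-closedNbhd G v) (suc-deg≤count-closedNbhd G w) ⟩
    count (closedNbhd G v) + count (closedNbhd G w)       ≡⟨ count-∨-disjoint _ _ disjoint ⟩
    count (λ x → closedNbhd G v x ∨ closedNbhd G w x)     ∎

eccentricity≤2 : ∀ {n} {G : Graph n} {v} →
  (∀ w → w ≢ v → ¬ T (adj G v w) → n ≤ suc (deg G v + deg G w)) → Eccentricity≤2 G v
eccentricity≤2 {G = G} {v} deg-sum w with w ≟ v | T? (adj G v w)
... | yes w≡v | _       = inj₁ w≡v
... | no _    | yes vw  = inj₂ (inj₁ vw)
... | no w≢v  | no ¬vw  = inj₂ (inj₂ (common-neighbour G (w≢v ∘ ≡.sym) ¬vw (deg-sum w w≢v ¬vw)))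

private
  n≤suc[A+B] : ∀ {n} a A b B → n ≤ suc (a + A) → n ≤ suc (b + B) → suc (suc (a + b)) ≤ n →
               n ≤ suc (A + B)
  n≤suc[A+B] {n} a A b B n≤a+A n≤b+B a+b<n = m≤n⇒m≤1+n (+-cancelˡ-≤ n n (A + B) (begin
    n + n                             ≤⟨ +-mono-≤ n≤a+A n≤b+B ⟩
    suc (a + A) + suc (b + B)         ≡⟨ regroup a A b B ⟩
    suc (suc (a + b)) + (A + B)       ≤⟨ +-monoˡ-≤ (A + B) a+b<n ⟩
    n + (A + B)                       ∎))
    where
    regroup : ∀ a A b B → suc (a + A) + suc (b + B) ≡ suc (suc (a + b)) + (A + B)
    regroup = solve 4 (λ a A b B → (con 1 :+ (a :+ A)) :+ (con 1 :+ (b :+ B))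
                                 := (con 2 :+ (a :+ b)) :+ (A :+ B)) refl

-- With u of minimum and v of maximum degree, either deg u + deg v ≥ n - 1, and then v has
-- eccentricity at most 2 in G, or deg u + deg v ≤ n - 2, and then u has it in the complement.
eccentricity≤2-or-complement : ∀ {m} (G : Graph (suc m)) →
  ∃ (Eccentricity≤2 G) ⊎ ∃ (Eccentricity≤2 (complement G))
eccentricity≤2-or-complement {m} G = decide (suc m ≤? suc (deg G u + deg G v))
  where
  u = argmin (deg G) zero (allFin (suc m))
  v = argmax (deg G) zero (allFin (suc m))
  deg-u≤ : ∀ w → deg G u ≤ deg G w
  deg-u≤ w = All.lookup (f[argmin]≤f[xs] {f = deg G} zero (allFin (suc m))) (∈-allFin w)
  ≤-deg-v : ∀ w → deg G w ≤ deg G v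
  ≤-deg-v w = All.lookup (f[xs]≤f[argmax] {f = deg G} zero (allFin (suc m))) (∈-allFin w)
  decide : Dec (suc m ≤ suc (deg G u + deg G v)) →
           ∃ (Eccentricity≤2 G) ⊎ ∃ (Eccentricity≤2 (complement G))
  decide (yes n≤) = inj₁ (v , eccentricity≤2 {G = G} λ w _ _ → begin
    suc m                       ≤⟨ n≤ ⟩
    suc (deg G u + deg G v)     ≡⟨ cong suc (+-comm (deg G u) (deg G v)) ⟩
    suc (deg G v + deg G u)     ≤⟨ s≤s (+-monoʳ-≤ (deg G v) (deg-u≤ w)) ⟩
    suc (deg G v + deg G w)     ∎)
  decide (no n≰) = inj₂ (u , eccentricity≤2 {G = complement G} λ w _ _ →
    n≤suc[A+B] (deg G u) (deg (complement G) u) (deg G w) (deg (complement G) w)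
               (n≤suc[deg+deg-complement] G u) (n≤suc[deg+deg-complement] G w)
               (≤-trans (s≤s (s≤s (+-monoʳ-≤ (deg G u) (≤-deg-v w)))) (≰⇒> n≰)))

n≤2j+2∧3[1+j]≤2n : ∀ n → 3 ≤ n → ∃ λ j → n ≤ j * 2 + 2 × 3 * suc j ≤ 2 * n
n≤2j+2∧3[1+j]≤2n 1 (s≤s ())
n≤2j+2∧3[1+j]≤2n 2 (s≤s (s≤s ()))
n≤2j+2∧3[1+j]≤2n 3 _ = 1 , n≤1+n 3 , ≤-refl
n≤2j+2∧3[1+j]≤2n 4 _ = 1 , ≤-refl , s≤s (s≤s (s≤s (s≤s (s≤s (s≤s z≤n)))))
n≤2j+2∧3[1+j]≤2n (suc (suc n@(suc (suc (suc _))))) _ with n≤2j+2∧3[1+j]≤2n n (s≤s (s≤s (s≤s z≤n)))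
... | j , n≤ , 3[1+j]≤2n = suc j , s≤s (s≤s n≤) , (begin
  3 * suc (suc j)         ≡⟨ *-suc 3 (suc j) ⟩
  3 + 3 * suc j           ≤⟨ +-monoʳ-≤ 3 3[1+j]≤2n ⟩
  3 + 2 * n               ≤⟨ n≤1+n _ ⟩
  4 + 2 * n               ≡⟨ ≡.cong (2 +_) (≡.sym (*-suc 2 n)) ⟩
  2 + 2 * suc n           ≡⟨ ≡.sym (*-suc 2 (suc n)) ⟩
  2 * suc (suc n)         ∎)

bg*bg-complement≤3[1+j] : ∀ {m} (G : Graph (suc (suc m))) →
  (∀ w → 2 ≤ deg G w) → (∀ w → 2 ≤ deg (complement G) w) →
  ∀ j → suc (suc m) ≤ j * 2 + 2 → bg G * bg (complement G) ≤ 3 * suc j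
bg*bg-complement≤3[1+j] G δ≥2 δḠ≥2 j n≤ =
  let Ḡ = complement G in
  [ (λ (v , ecc) → *-mono-≤ (bg≤3 G v ecc) (δ≥2⇒bg≤suc Ḡ δḠ≥2 j n≤))
  , (λ (u , ecc) → ≤-trans (*-mono-≤ (δ≥2⇒bg≤suc G δ≥2 j n≤) (bg≤3 Ḡ u ecc)) (≤-reflexive (*-comm (suc j) 3)))
  ]′ (eccentricity≤2-or-complement G)

bg*bg-complement≤2n : ∀ {m} (G : Graph (suc (suc m))) → bg G * bg (complement G) ≤ 2 * suc (suc m)
bg*bg-complement≤2n {m} G = cases (any? λ u → deg G u ≤? 1) (any? λ v → N ≤? 2 + deg G v)
  where
  N  = suc (suc m)
  Ḡ  = complement G
  cases : Dec (∃ λ u → deg G u ≤ 1) → Dec (∃ λ v → N ≤ 2 + deg G v) → bg G * bg Ḡ ≤ 2 * N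
  cases (yes (u , deg≤1)) _ = begin
    bg G * bg Ḡ      ≤⟨ *-mono-≤ (bg≤n G) (bg≤2 Ḡ u (≤-trans (n≤suc[deg+deg-complement] G u) (s≤s (+-monoˡ-≤ _ deg≤1)))) ⟩
    N * 2            ≡⟨ *-comm N 2 ⟩
    2 * N            ∎
  cases (no _) (yes (v , n≤)) = *-mono-≤ (bg≤2 G v n≤) (bg≤n Ḡ)
  cases (no no-δ≤1) (no no-Δ≥n-2) =
    let j , n≤2j+2 , 3[1+j]≤2n = n≤2j+2∧3[1+j]≤2n N (≤-trans (s≤s (s≤s (s≤s z≤n))) (deg<n-2 zero))
    in ≤-trans (bg*bg-complement≤3[1+j] G δ≥2 δḠ≥2 j n≤2j+2) 3[1+j]≤2n
    where
    deg<n-2 : ∀ w → suc (2 + deg G w) ≤ N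
    deg<n-2 w = ≰⇒> (λ h → no-Δ≥n-2 (w , h))
    δ≥2 : ∀ w → 2 ≤ deg G w
    δ≥2 w = ≰⇒> (λ h → no-δ≤1 (w , h))
    δḠ≥2 : ∀ w → 2 ≤ deg Ḡ w
    δḠ≥2 w = +-cancelˡ-≤ (deg G w) 2 (deg Ḡ w) (begin
      deg G w + 2             ≡⟨ +-comm (deg G w) 2 ⟩
      2 + deg G w             ≤⟨ ≤-pred (≤-trans (deg<n-2 w) (n≤suc[deg+deg-complement] G w)) ⟩
      deg G w + deg Ḡ w       ∎)

proposition3p3 : (n : ℕ) → 2 ≤ n → (G : Graph n) →
    (4 ≤ bg G * bg (complement G)) × (bg G * bg (complement G) ≤ 2 * n)
proposition3p3 (suc (suc m)) (s≤s (s≤s z≤n)) G =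
  *-mono-≤ (2≤bg G) (2≤bg (complement G)) , bg*bg-complement≤2n G
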